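{- Let $n\ge2$ be an integer. The $(n+3)$-tuple \[\left(2n+1,\ \tfrac{n+1}{2n+1},\ 3,\ \underbrace{2,\dots,2}_{n-1},\ \tfrac{2n}{2n+1}\right)\] is an irreducible $\lambda$-quiddity over $\mathbb{Q}$.
   Context: For a commutative unitary ring $B$ and $a_1,\dots,a_n\in B$, set $M_n(a_1,\dots,a_n)=\begin{pmatrix}a_n&-1\\1&0\end{pmatrix}\cdots\begin{pmatrix}a_1&-1\\1&0\end{pmatrix}$. An $n$-tuple $(a_1,\dots,a_n)\in B^n$ is a $\lambda$-quiddity over $B$ if $M_n(a_1,\dots,a_n)=\epsilon\,\mathrm{Id}$ for some $\epsilon\in\{\pm1_B\}$. For $(a_1,\dots,a_n)\in B^n$, $(b_1,\dots,b_m)\in B^m$ define $(a_1,\dots,a_n)\oplus(b_1,\dots,b_m)=(a_1+b_m,a_2,\dots,a_{n-1},a_n+b_1,b_2,\dots,b_{m-1})$. Two $n$-tuples are equivalent ($\sim$) if one is obtained from the other or from its reversal by a cyclic rotation. A $\lambda$-quiddity $(c_1,\dots,c_n)$ with $n\ge3$ is reducible if there exist a $\lambda$-quiddity $(b_1,\dots,b_l)$ and $(a_1,\dots,a_m)\in B^m$ with $m,l\ge3$ and $(c_1,\dots,c_n)\sim(a_1,\dots,a_m)\oplus(b_1,\dots,b_l)$; otherwise it is irreducible. -}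

module Defs where

open import Data.Nat using (ℕ; zero; suc; _<_; _≤_; _∸_) renaming (_*_ to _*ℕ_)
open import Data.Integer using (+_)
open import Data.Rational using (ℚ; _+_; _*_; -_; 0ℚ; 1ℚ; _/_)
open import Data.List using (List; []; _∷_; _++_; length; reverse; drop; take; replicate; foldl)
open import Data.Product using (Σ; ∃; _×_; _,_)
open import Data.Sum using (_⊎_)
open import Relation.Nullary using (¬_)
open import Relation.Binary.PropositionalEquality using (_≡_)

record Mat2 : Set where
  constructor mat
  field
    m11 m12 m21 m22 : ℚ

_·_ : Mat2 → Mat2 → Mat2
mat a b c d · mat e f g h =
  mat (a * e + b * g) (a * f + b * h) (c * e + d * g) (c * f + d * h)

Id : Mat2
Id = mat 1ℚ 0ℚ 0ℚ 1ℚ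

negId : Mat2
negId = mat (- 1ℚ) 0ℚ 0ℚ (- 1ℚ)

elem : ℚ → Mat2
elem a = mat a (- 1ℚ) 1ℚ 0ℚ

-- M_n(a_1,...,a_n) = elem a_n · ... · elem a_1
M : List ℚ → Mat2
M = foldl (λ acc a → elem a · acc) Id

IsλQuiddity : List ℚ → Set
IsλQuiddity a = (M a ≡ Id) ⊎ (M a ≡ negId)

lastOr0 : List ℚ → ℚ
lastOr0 [] = 0ℚ
lastOr0 (x ∷ []) = x
lastOr0 (x ∷ y ∷ xs) = lastOr0 (y ∷ xs)

dropLast : List ℚ → List ℚ
dropLast [] = []
dropLast (x ∷ []) = []
dropLast (x ∷ y ∷ xs) = x ∷ dropLast (y ∷ xs)

-- (a_1..a_n) ⊕ (b_1..b_m) = (a_1 + b_m, a_2, ..., a_{n-1}, a_n + b_1, b_2, ..., b_{m-1})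
-- (only meaningful for n, m ≥ 2; it is only used with n, m ≥ 3)
_⊕_ : List ℚ → List ℚ → List ℚ
(a₁ ∷ as) ⊕ (b₁ ∷ bs) =
  (a₁ + lastOr0 (b₁ ∷ bs)) ∷ (dropLast as ++ ((lastOr0 as + b₁) ∷ dropLast bs))
_ ⊕ _ = []

rotate : ℕ → List ℚ → List ℚ
rotate k a = drop k a ++ take k a

_∼_ : List ℚ → List ℚ → Set
c ∼ a = Σ ℕ λ k → k < length a × ((c ≡ rotate k a) ⊎ (c ≡ rotate k (reverse a)))

Reducible : List ℚ → Set
Reducible c =
  Σ (List ℚ) λ a → Σ (List ℚ) λ b →
    IsλQuiddity b × 3 ≤ length a × 3 ≤ length b × (c ∼ (a ⊕ b))

IsIrreducibleλQuiddity : List ℚ → Set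
IsIrreducibleλQuiddity c = IsλQuiddity c × 3 ≤ length c × ¬ Reducible c

tuple : ℕ → List ℚ
tuple n =
  (+ suc (2 *ℕ n) / 1) ∷ (+ suc n / suc (2 *ℕ n)) ∷ (+ 3 / 1) ∷
    (replicate (n ∸ 1) (+ 2 / 1) ++ ((+ (2 *ℕ n) / suc (2 *ℕ n)) ∷ []))

-- If c ∼ a ⊕ b with b = (b₁, …, b_l) a λ-quiddity, then M(b) = ±Id forces the continuant of the
-- middle part (b₂, …, b_{l-1}) to be ±1, and that middle part is a cyclic window of c of length
-- between 1 and |c| − 3.  So c is irreducible as soon as no such window has continuant ±1.
-- For the tuple (2n+1, (n+1)/(2n+1), 3, 2, …, 2, 2n/(2n+1)) the continuants K of the windows
-- starting at a fixed position follow K(w a) = a K(w) − K(w⁻), w⁻ being w without its last entry.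
-- Along a run of 2s they form an arithmetic progression, and up to length n they are integers
-- ≥ 2 or fractions k/(2n+1) with 0 < k ≤ 2n, never ±1.  Computing the whole cycle the same way
-- gives M = −Id.
module Submission where

open import Data.Integer as ℤ using (+_)
import Data.Integer.Properties as ℤ
open import Data.List using (List; []; _∷_; _++_; length; reverse; drop; take; replicate; foldl)
import Data.List.Properties as List
open import Data.Nat as ℕ using (ℕ; zero; suc; _≤_; _<_; z≤n; s≤s)
import Data.Nat.Properties as ℕ
import Data.Nat.Tactic.RingSolver as ℕ-Solver
open import Data.Product using (∃; _×_; _,_; proj₁)
open import Data.Rational using (ℚ; _+_; _*_; _-_; -_; 0ℚ; 1ℚ; _/_; fromℚᵘ; toℚᵘ)
open import Data.Rational.Properties
  using ( +-*-commutativeRing; _≟_; toℚᵘ-injective; toℚᵘ-fromℚᵘ; toℚᵘ-homo-+; toℚᵘ-homo-*; fromℚᵘ-cong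
        ; /-injective-≃; +-inverseˡ; *-identityˡ; *-identityʳ; *-assoc; *-distribʳ-+; neg-distribˡ-*; neg-injective)
import Data.Rational.Unnormalised as ℚᵘ
import Data.Rational.Unnormalised.Properties as ℚᵘ
open import Data.Sum using (_⊎_; inj₁; inj₂)
open import Relation.Binary.PropositionalEquality
open import Relation.Nullary using (¬_; yes; no; contradiction)
open import Relation.Nullary.Decidable using (dec⇒maybe)
open import Tactic.RingSolver using (solve-∀)
import Tactic.RingSolver.Core.AlmostCommutativeRing as ACR

open import Defs

ℚ-ring : ACR.AlmostCommutativeRing _ _
ℚ-ring = ACR.fromCommutativeRing +-*-commutativeRing (λ x → dec⇒maybe (0ℚ ≟ x))

fromℚᵘ-homo-+ : ∀ p q → fromℚᵘ (p ℚᵘ.+ q) ≡ fromℚᵘ p + fromℚᵘ q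
fromℚᵘ-homo-+ p q = toℚᵘ-injective (begin
  toℚᵘ (fromℚᵘ (p ℚᵘ.+ q))                ≈⟨ toℚᵘ-fromℚᵘ (p ℚᵘ.+ q) ⟩
  p ℚᵘ.+ q                                ≈⟨ ℚᵘ.+-cong (toℚᵘ-fromℚᵘ p) (toℚᵘ-fromℚᵘ q) ⟨
  toℚᵘ (fromℚᵘ p) ℚᵘ.+ toℚᵘ (fromℚᵘ q)    ≈⟨ toℚᵘ-homo-+ (fromℚᵘ p) (fromℚᵘ q) ⟨
  toℚᵘ (fromℚᵘ p + fromℚᵘ q)              ∎)
  where open ℚᵘ.≃-Reasoning

fromℚᵘ-homo-* : ∀ p q → fromℚᵘ (p ℚᵘ.* q) ≡ fromℚᵘ p * fromℚᵘ q
fromℚᵘ-homo-* p q = toℚᵘ-injective (begin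
  toℚᵘ (fromℚᵘ (p ℚᵘ.* q))                ≈⟨ toℚᵘ-fromℚᵘ (p ℚᵘ.* q) ⟩
  p ℚᵘ.* q                                ≈⟨ ℚᵘ.*-cong (toℚᵘ-fromℚᵘ p) (toℚᵘ-fromℚᵘ q) ⟨
  toℚᵘ (fromℚᵘ p) ℚᵘ.* toℚᵘ (fromℚᵘ q)    ≈⟨ toℚᵘ-homo-* (fromℚᵘ p) (fromℚᵘ q) ⟨
  toℚᵘ (fromℚᵘ p * fromℚᵘ q)              ∎)
  where open ℚᵘ.≃-Reasoning

ι : ℕ → ℚ
ι k = + k / 1

ιᵘ : ℕ → ℚᵘ.ℚᵘ
ιᵘ k = ℚᵘ.mkℚᵘ (+ k) 0

ι-+ : ∀ a b → ι (a ℕ.+ b) ≡ ι a + ι b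
ι-+ a b = trans (fromℚᵘ-cong {ιᵘ (a ℕ.+ b)} {ιᵘ a ℚᵘ.+ ιᵘ b} (ℚᵘ.*≡* eq)) (fromℚᵘ-homo-+ (ιᵘ a) (ιᵘ b))
  where
  eq : + (a ℕ.+ b) ℤ.* + 1 ≡ (+ a ℤ.* + 1 ℤ.+ + b ℤ.* + 1) ℤ.* + 1
  eq rewrite ℤ.*-identityʳ (+ a) | ℤ.*-identityʳ (+ b) = cong (ℤ._* + 1) (ℤ.pos-+ a b)

ι-* : ∀ a b → ι (a ℕ.* b) ≡ ι a * ι b
ι-* a b = trans (fromℚᵘ-cong {ιᵘ (a ℕ.* b)} {ιᵘ a ℚᵘ.* ιᵘ b} (ℚᵘ.*≡* eq)) (fromℚᵘ-homo-* (ιᵘ a) (ιᵘ b))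
  where
  eq : + (a ℕ.* b) ℤ.* + 1 ≡ (+ a ℤ.* + b) ℤ.* + 1
  eq = cong (ℤ._* + 1) (ℤ.pos-* a b)

ι-suc : ∀ k → ι (suc k) ≡ 1ℚ + ι k
ι-suc = ι-+ 1

ι-injective : ∀ {a b} → ι a ≡ ι b → a ≡ b
ι-injective {a} {b} eq with /-injective-≃ (ιᵘ a) (ιᵘ b) eq
... | ℚᵘ.*≡* a*1≡b*1 = ℤ.+-injective (subst₂ _≡_ (ℤ.*-identityʳ (+ a)) (ℤ.*-identityʳ (+ b)) a*1≡b*1)

/-*-cancel : ∀ a d → (+ a / suc d) * ι (suc d) ≡ ι a
/-*-cancel a d = trans (sym (fromℚᵘ-homo-* (ℚᵘ.mkℚᵘ (+ a) d) (ιᵘ (suc d))))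
  (fromℚᵘ-cong {ℚᵘ.mkℚᵘ (+ a) d ℚᵘ.* ιᵘ (suc d)} {ιᵘ a} (ℚᵘ.*≡* (ℤ.*-assoc (+ a) (+ suc d) (+ 1))))

*1/-*-cancel : ∀ x d → (x * (+ 1 / suc d)) * ι (suc d) ≡ x
*1/-*-cancel x d = begin
  (x * (+ 1 / suc d)) * ι (suc d)   ≡⟨ *-assoc x _ _ ⟩
  x * ((+ 1 / suc d) * ι (suc d))   ≡⟨ cong (x *_) (/-*-cancel 1 d) ⟩
  x * 1ℚ                            ≡⟨ *-identityʳ x ⟩
  x                                 ∎
  where open ≡-Reasoning

/≡ι*1/ : ∀ a d → + a / suc d ≡ ι a * (+ 1 / suc d)
/≡ι*1/ a d = begin
  x                                 ≡⟨ *1/-*-cancel x d ⟨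
  (x * (+ 1 / suc d)) * ι (suc d)   ≡⟨ swap x (+ 1 / suc d) (ι (suc d)) ⟩
  (x * ι (suc d)) * (+ 1 / suc d)   ≡⟨ cong (_* (+ 1 / suc d)) (/-*-cancel a d) ⟩
  ι a * (+ 1 / suc d)               ∎
  where
  open ≡-Reasoning
  x = + a / suc d
  swap : ∀ x y z → (x * y) * z ≡ (x * z) * y
  swap = solve-∀ ℚ-ring

ι*-+ : ∀ a b x → ι a * x + ι b * x ≡ ι (a ℕ.+ b) * x
ι*-+ a b x = trans (sym (*-distribʳ-+ x (ι a) (ι b))) (cong (_* x) (sym (ι-+ a b)))

ι*-suc : ∀ a x → ι a * x + x ≡ ι (suc a) * x
ι*-suc a x = trans (identity (ι a) x) (cong (_* x) (sym (ι-suc a)))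
  where
  identity : ∀ y x → y * x + x ≡ (1ℚ + y) * x
  identity = solve-∀ ℚ-ring

-- The ring solver cannot use the relation u (1 + 2N) = 1 satisfied by N = n and u = 1/(2n+1):
-- identities that need it are proved as x = y + c (u (1 + 2N) − 1) with an explicit cofactor c.
modulo : ∀ {x r} y c → r ≡ 0ℚ → x ≡ y + c * r → x ≡ y
modulo {x} y c r≡0 x≡y+c*r = trans x≡y+c*r (trans (cong (λ r → y + c * r) r≡0) (identity y c))
  where
  identity : ∀ y c → y + c * 0ℚ ≡ y
  identity = solve-∀ ℚ-ring

cong₃ : ∀ (f : ℚ → ℚ → ℚ → ℚ) {x x′ y y′ z z′} →
        x ≡ x′ → y ≡ y′ → z ≡ z′ → f x y z ≡ f x′ y′ z′
cong₃ f refl refl refl = refl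

_≡±1 : ℚ → Set
x ≡±1 = x ≡ 1ℚ ⊎ x ≡ - 1ℚ

ι≢-ι-suc : ∀ a b → ι a ≢ - ι (suc b)
ι≢-ι-suc a b eq = ℕ.1+n≢0 (ℕ.m+n≡0⇒n≡0 a (ι-injective (begin
  ι (a ℕ.+ suc b)           ≡⟨ ι-+ a (suc b) ⟩
  ι a + ι (suc b)           ≡⟨ cong (_+ ι (suc b)) eq ⟩
  - ι (suc b) + ι (suc b)   ≡⟨ +-inverseˡ (ι (suc b)) ⟩
  ι 0                       ∎)))
  where open ≡-Reasoning

ι-≢±1 : ∀ k → 2 ≤ k → ¬ ι k ≡±1
ι-≢±1 k 2≤k (inj₁ eq) = ℕ.<⇒≢ 2≤k (sym (ι-injective {k} {1} eq))
ι-≢±1 k _   (inj₂ eq) = ι≢-ι-suc k 0 eq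

ι*1/-≢±1 : ∀ k d → k ≤ d → ¬ (ι k * (+ 1 / suc d)) ≡±1
ι*1/-≢±1 k d k≤d (inj₁ eq) = ℕ.<⇒≢ (s≤s k≤d) (ι-injective (begin
  ι k                                 ≡⟨ *1/-*-cancel (ι k) d ⟨
  (ι k * (+ 1 / suc d)) * ι (suc d)   ≡⟨ cong (_* ι (suc d)) eq ⟩
  1ℚ * ι (suc d)                      ≡⟨ *-identityˡ (ι (suc d)) ⟩
  ι (suc d)                           ∎))
  where open ≡-Reasoning
ι*1/-≢±1 k d _   (inj₂ eq) = ι≢-ι-suc k d (begin
  ι k                                 ≡⟨ *1/-*-cancel (ι k) d ⟨
  (ι k * (+ 1 / suc d)) * ι (suc d)   ≡⟨ cong (_* ι (suc d)) eq ⟩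
  - 1ℚ * ι (suc d)                    ≡⟨ neg-distribˡ-* 1ℚ (ι (suc d)) ⟨
  - (1ℚ * ι (suc d))                  ≡⟨ cong -_ (*-identityˡ (ι (suc d))) ⟩
  - ι (suc d)                         ∎)
  where open ≡-Reasoning

-- A state (x , y) holds the continuants of the prefix read so far and of that prefix without
-- its last entry.
step : ℚ → ℚ × ℚ → ℚ × ℚ
step a (x , y) = a * x - y , x

run : ℚ × ℚ → List ℚ → ℚ × ℚ
run = foldl (λ v a → step a v)

continuant : List ℚ → ℚ
continuant L = proj₁ (run (1ℚ , 0ℚ) L)

open Mat2

mat-cong : ∀ {a b c d a′ b′ c′ d′} →
           a ≡ a′ → b ≡ b′ → c ≡ c′ → d ≡ d′ → mat a b c d ≡ mat a′ b′ c′ d′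
mat-cong refl refl refl refl = refl

col₁ col₂ : Mat2 → ℚ × ℚ
col₁ A = m11 A , m21 A
col₂ A = m12 A , m22 A

fromColumns : ℚ × ℚ → ℚ × ℚ → Mat2
fromColumns (a , c) (b , d) = mat a b c d

elem-·-column : ∀ a x y → (a * x + - 1ℚ * y , 1ℚ * x + 0ℚ * y) ≡ step a (x , y)
elem-·-column a x y = cong₂ _,_ (upper a x y) (lower x y)
  where
  upper : ∀ a x y → a * x + - 1ℚ * y ≡ a * x - y
  upper = solve-∀ ℚ-ring
  lower : ∀ x y → 1ℚ * x + 0ℚ * y ≡ x
  lower = solve-∀ ℚ-ring

col₁-elem-· : ∀ a A → col₁ (elem a · A) ≡ step a (col₁ A)
col₁-elem-· a (mat p q r s) = elem-·-column a p r

col₂-elem-· : ∀ a A → col₂ (elem a · A) ≡ step a (col₂ A)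
col₂-elem-· a (mat p q r s) = elem-·-column a q s

foldl-columns : ∀ L A →
                foldl (λ acc a → elem a · acc) A L ≡ fromColumns (run (col₁ A) L) (run (col₂ A) L)
foldl-columns []      A = refl
foldl-columns (a ∷ L) A = trans (foldl-columns L (elem a · A))
  (cong₂ (λ v w → fromColumns (run v L) (run w L)) (col₁-elem-· a A) (col₂-elem-· a A))

M-columns : ∀ L → M L ≡ fromColumns (run (1ℚ , 0ℚ) L) (run (0ℚ , 1ℚ) L)
M-columns L = foldl-columns L Id

m11-M : ∀ L → m11 (M L) ≡ continuant L
m11-M L = cong m11 (M-columns L)

·-assoc : ∀ A B C → (A · B) · C ≡ A · (B · C)
·-assoc (mat a b c d) (mat e f g h) (mat i j k l) =
  mat-cong (entry a b e f g h i k) (entry a b e f g h j l) (entry c d e f g h i k) (entry c d e f g h j l)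
  where
  entry : ∀ a b e f g h i k →
          (a * e + b * g) * i + (a * f + b * h) * k ≡ a * (e * i + f * k) + b * (g * i + h * k)
  entry = solve-∀ ℚ-ring

·-identityˡ : ∀ A → Id · A ≡ A
·-identityˡ (mat a b c d) = mat-cong (upper a c) (upper b d) (lower a c) (lower b d)
  where
  upper : ∀ x y → 1ℚ * x + 0ℚ * y ≡ x
  upper = solve-∀ ℚ-ring
  lower : ∀ x y → 0ℚ * x + 1ℚ * y ≡ y
  lower = solve-∀ ℚ-ring

·-identityʳ : ∀ A → A · Id ≡ A
·-identityʳ (mat a b c d) = mat-cong (left a b) (right a b) (left c d) (right c d)
  where
  left : ∀ x y → x * 1ℚ + y * 0ℚ ≡ x
  left = solve-∀ ℚ-ring
  right : ∀ x y → x * 0ℚ + y * 1ℚ ≡ y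
  right = solve-∀ ℚ-ring

foldl-· : ∀ L A → foldl (λ acc a → elem a · acc) A L ≡ M L · A
foldl-· []      A = sym (·-identityˡ A)
foldl-· (a ∷ L) A = begin
  foldl _ (elem a · A) L      ≡⟨ foldl-· L (elem a · A) ⟩
  M L · (elem a · A)          ≡⟨ cong (λ B → M L · (elem a · B)) (·-identityˡ A) ⟨
  M L · (elem a · (Id · A))   ≡⟨ cong (M L ·_) (·-assoc (elem a) Id A) ⟨
  M L · ((elem a · Id) · A)   ≡⟨ ·-assoc (M L) (elem a · Id) A ⟨
  (M L · (elem a · Id)) · A   ≡⟨ cong (_· A) (foldl-· L (elem a · Id)) ⟨
  M (a ∷ L) · A               ∎
  where open ≡-Reasoning

M-∷ : ∀ a L → M (a ∷ L) ≡ M L · elem a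
M-∷ a L = trans (foldl-· L (elem a · Id)) (cong (M L ·_) (·-identityʳ (elem a)))

M-∷ʳ : ∀ L a → M (L ++ a ∷ []) ≡ elem a · M L
M-∷ʳ L a = List.foldl-∷ʳ _ Id a L

-- S Aᵀ S with S = diag(1, −1): it fixes every elem a and reverses products.
signedTranspose : Mat2 → Mat2
signedTranspose (mat a b c d) = mat a (- c) (- b) d

signedTranspose-· : ∀ A B → signedTranspose (A · B) ≡ signedTranspose B · signedTranspose A
signedTranspose-· (mat a b c d) (mat e f g h) =
  mat-cong (e₁₁ a b e g) (e₁₂ c d e g) (e₂₁ a b f h) (e₂₂ c d f h)
  where
  e₁₁ : ∀ a b e g → a * e + b * g ≡ e * a + (- g) * (- b)
  e₁₁ = solve-∀ ℚ-ring
  e₁₂ : ∀ c d e g → - (c * e + d * g) ≡ e * (- c) + (- g) * d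
  e₁₂ = solve-∀ ℚ-ring
  e₂₁ : ∀ a b f h → - (a * f + b * h) ≡ (- f) * a + h * (- b)
  e₂₁ = solve-∀ ℚ-ring
  e₂₂ : ∀ c d f h → c * f + d * h ≡ (- f) * (- c) + h * d
  e₂₂ = solve-∀ ℚ-ring

M-reverse : ∀ L → M (reverse L) ≡ signedTranspose (M L)
M-reverse []      = refl
M-reverse (a ∷ L) = begin
  M (reverse (a ∷ L))                                ≡⟨ cong M (List.unfold-reverse a L) ⟩
  M (reverse L ++ a ∷ [])                            ≡⟨ M-∷ʳ (reverse L) a ⟩
  elem a · M (reverse L)                             ≡⟨ cong (elem a ·_) (M-reverse L) ⟩
  signedTranspose (elem a) · signedTranspose (M L)   ≡⟨ signedTranspose-· (M L) (elem a) ⟨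
  signedTranspose (M L · elem a)                     ≡⟨ cong signedTranspose (M-∷ a L) ⟨
  signedTranspose (M (a ∷ L))                        ∎
  where open ≡-Reasoning

continuant-reverse : ∀ L → continuant (reverse L) ≡ continuant L
continuant-reverse L = begin
  continuant (reverse L)   ≡⟨ m11-M (reverse L) ⟨
  m11 (M (reverse L))      ≡⟨ cong m11 (M-reverse L) ⟩
  m11 (M L)                ≡⟨ m11-M L ⟩
  continuant L             ∎
  where open ≡-Reasoning

m22-elem-·-·-elem : ∀ a X b → m22 ((elem a · X) · elem b) ≡ - m11 X
m22-elem-·-·-elem a (mat p q r s) b = entry p q r s
  where
  entry : ∀ p q r s → (1ℚ * p + 0ℚ * r) * - 1ℚ + (1ℚ * q + 0ℚ * s) * 0ℚ ≡ - p
  entry = solve-∀ ℚ-ring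

λ-quiddity-inner-±1 : ∀ b Q b′ → IsλQuiddity (b ∷ Q ++ b′ ∷ []) → continuant Q ≡±1
λ-quiddity-inner-±1 b Q b′ = conclude
  where
  m22≡-continuant : m22 (M (b ∷ Q ++ b′ ∷ [])) ≡ - continuant Q
  m22≡-continuant = begin
    m22 (M (b ∷ Q ++ b′ ∷ []))        ≡⟨ cong m22 (M-∷ b (Q ++ b′ ∷ [])) ⟩
    m22 (M (Q ++ b′ ∷ []) · elem b)   ≡⟨ cong (λ X → m22 (X · elem b)) (M-∷ʳ Q b′) ⟩
    m22 ((elem b′ · M Q) · elem b)    ≡⟨ m22-elem-·-·-elem b′ (M Q) b ⟩
    - m11 (M Q)                       ≡⟨ cong -_ (m11-M Q) ⟩
    - continuant Q                    ∎
    where open ≡-Reasoning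
  conclude : IsλQuiddity (b ∷ Q ++ b′ ∷ []) → continuant Q ≡±1
  conclude (inj₁ M≡Id)    = inj₂ (neg-injective (trans (sym m22≡-continuant) (cong m22 M≡Id)))
  conclude (inj₂ M≡negId) = inj₁ (neg-injective (trans (sym m22≡-continuant) (cong m22 M≡negId)))

drop-++ : ∀ n (xs ys : List ℚ) → drop n (xs ++ ys) ≡ drop n xs ++ drop (n ℕ.∸ length xs) ys
drop-++ zero    []       ys = refl
drop-++ zero    (x ∷ xs) ys = refl
drop-++ (suc n) []       ys = refl
drop-++ (suc n) (x ∷ xs) ys = drop-++ n xs ys

drop-length-++ : ∀ (xs ys : List ℚ) → drop (length xs) (xs ++ ys) ≡ ys
drop-length-++ []       ys = refl
drop-length-++ (x ∷ xs) ys = drop-length-++ xs ys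

drop-replicate-++ : ∀ i r (x : ℚ) L → drop i (replicate (i ℕ.+ r) x ++ L) ≡ replicate r x ++ L
drop-replicate-++ zero    r x L = refl
drop-replicate-++ (suc i) r x L = drop-replicate-++ i r x L

length-rotate : ∀ k L → length (rotate k L) ≡ length L
length-rotate k L = begin
  length (drop k L ++ take k L)             ≡⟨ List.length-++ (drop k L) ⟩
  length (drop k L) ℕ.+ length (take k L)   ≡⟨ ℕ.+-comm (length (drop k L)) _ ⟩
  length (take k L) ℕ.+ length (drop k L)   ≡⟨ List.length-++ (take k L) ⟨
  length (take k L ++ drop k L)             ≡⟨ cong length (List.take++drop≡id k L) ⟩
  length L                                  ∎
  where open ≡-Reasoning

rotate-infix : ∀ k {L} A W B → L ≡ A ++ W ++ B → ∃ λ X → ∃ λ Y → X ++ W ++ Y ≡ rotate k L ++ rotate k L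
rotate-infix k {L} A W B refl = drop k L ++ A , B ++ take k L , (begin
  (D ++ A) ++ W ++ (B ++ T)   ≡⟨ List.++-assoc D A _ ⟩
  D ++ A ++ W ++ (B ++ T)     ≡⟨ cong (λ Z → D ++ A ++ Z) (List.++-assoc W B T) ⟨
  D ++ A ++ (W ++ B) ++ T     ≡⟨ cong (D ++_) (List.++-assoc A (W ++ B) T) ⟨
  D ++ L ++ T                 ≡⟨ cong (λ Z → D ++ Z ++ T) (List.take++drop≡id k L) ⟨
  D ++ (T ++ D) ++ T          ≡⟨ cong (D ++_) (List.++-assoc T D T) ⟩
  D ++ T ++ D ++ T            ≡⟨ List.++-assoc D T (D ++ T) ⟨
  (D ++ T) ++ D ++ T          ∎)
  where
  open ≡-Reasoning
  D = drop k L
  T = take k L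

dropLast-++-lastOr0 : ∀ x xs → x ∷ xs ≡ dropLast (x ∷ xs) ++ lastOr0 (x ∷ xs) ∷ []
dropLast-++-lastOr0 x []       = refl
dropLast-++-lastOr0 x (y ∷ xs) = cong (x ∷_) (dropLast-++-lastOr0 y xs)

length-dropLast : ∀ x xs → length (dropLast (x ∷ xs)) ≡ length xs
length-dropLast x []       = refl
length-dropLast x (y ∷ xs) = cong suc (length-dropLast y xs)

⊕-≡-++-dropLast : ∀ a₁ a₂ as b bs → ∃ λ P →
                  length P ≡ length (a₁ ∷ a₂ ∷ as) × (a₁ ∷ a₂ ∷ as) ⊕ (b ∷ bs) ≡ P ++ dropLast bs
⊕-≡-++-dropLast a₁ a₂ as b bs =
  P , |P| , cong (_ ∷_) (sym (List.++-assoc (dropLast (a₂ ∷ as)) _ (dropLast bs)))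
  where
  P = (a₁ + lastOr0 (b ∷ bs)) ∷ (dropLast (a₂ ∷ as) ++ (lastOr0 (a₂ ∷ as) + b) ∷ [])
  |P| : length P ≡ length (a₁ ∷ a₂ ∷ as)
  |P| = cong suc (trans (List.length-++ (dropLast (a₂ ∷ as)))
          (trans (cong (ℕ._+ 1) (length-dropLast a₂ as)) (ℕ.+-comm (length as) 1)))

-- Cyclic windows of c are read as infixes of c ++ c that start in the first copy.
record ±1-Window (c : List ℚ) : Set where
  field
    start        : ℕ
    window after : List ℚ
    start<length : start < length c
    splits       : drop start (c ++ c) ≡ window ++ after
    nonempty     : window ≢ []
    short        : length window ℕ.+ 3 ≤ length c
    continuant±1 : continuant window ≡±1

infix⇒±1-Window : ∀ c X W Y → X ++ W ++ Y ≡ c ++ c → W ≢ [] → length W ℕ.+ 3 ≤ length c →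
                  continuant W ≡±1 → ±1-Window c
infix⇒±1-Window c X W Y X++W++Y≡c++c W≢[] short ±1 with length X ℕ.<? length c
... | yes |X|<|c| = record
  { start = length X ; window = W ; after = Y ; start<length = |X|<|c| ; splits = at-X
  ; nonempty = W≢[] ; short = short ; continuant±1 = ±1 }
  where
  at-X : drop (length X) (c ++ c) ≡ W ++ Y
  at-X = trans (cong (drop (length X)) (sym X++W++Y≡c++c)) (drop-length-++ X (W ++ Y))
... | no |X|≮|c| = record
  { start = t ; window = W ; after = Y ++ c ; start<length = t<|c| ; splits = at-t
  ; nonempty = W≢[] ; short = short ; continuant±1 = ±1 }
  where
  open ≡-Reasoning
  t = length X ℕ.∸ length c
  in-first : drop t c ≡ W ++ Y
  in-first = begin
    drop t c                        ≡⟨ cong (_++ drop t c) (List.drop-all (length X) c (ℕ.≮⇒≥ |X|≮|c|)) ⟨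
    drop (length X) c ++ drop t c   ≡⟨ drop-++ (length X) c c ⟨
    drop (length X) (c ++ c)        ≡⟨ cong (drop (length X)) X++W++Y≡c++c ⟨
    drop (length X) (X ++ W ++ Y)   ≡⟨ drop-length-++ X (W ++ Y) ⟩
    W ++ Y                          ∎
  t<|c| : t < length c
  t<|c| with t ℕ.<? length c
  ... | yes t<|c| = t<|c|
  ... | no  t≮|c| =
    contradiction (List.++-conicalˡ W Y (trans (sym in-first) (List.drop-all t c (ℕ.≮⇒≥ t≮|c|)))) W≢[]
  t∸|c|≡0 : t ℕ.∸ length c ≡ 0
  t∸|c|≡0 = ℕ.m≤n⇒m∸n≡0 (ℕ.<⇒≤ t<|c|)
  at-t : drop t (c ++ c) ≡ W ++ Y ++ c
  at-t = begin
    drop t (c ++ c)                       ≡⟨ drop-++ t c c ⟩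
    drop t c ++ drop (t ℕ.∸ length c) c   ≡⟨ cong₂ (λ Z s → Z ++ drop s c) in-first t∸|c|≡0 ⟩
    (W ++ Y) ++ c                         ≡⟨ List.++-assoc W Y c ⟩
    W ++ Y ++ c                           ∎

rotation⇒±1-Window : ∀ {c} k L A W B → c ≡ rotate k L → L ≡ A ++ W ++ B → W ≢ [] →
                     length W ℕ.+ 3 ≤ length L → continuant W ≡±1 → ±1-Window c
rotation⇒±1-Window k L A W B refl L≡A++W++B W≢[] short ±1
  with X , Y , X++W++Y≡c++c ← rotate-infix k A W B L≡A++W++B =
  infix⇒±1-Window _ X W Y X++W++Y≡c++c W≢[] (subst (length W ℕ.+ 3 ≤_) (sym (length-rotate k L)) short) ±1

reducible⇒±1-Window : ∀ c → Reducible c → ±1-Window c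
reducible⇒±1-Window c (a₁ ∷ a₂ ∷ as , b ∷ b₂ ∷ b₃ ∷ bs , quiddity , 3≤|a| , _ , c∼a⊕b)
  with P , |P|≡|a| , a⊕b≡P++W ← ⊕-≡-++-dropLast a₁ a₂ as b (b₂ ∷ b₃ ∷ bs) = window c∼a⊕b
  where
  a⊕b = (a₁ ∷ a₂ ∷ as) ⊕ (b ∷ b₂ ∷ b₃ ∷ bs)
  W = dropLast (b₂ ∷ b₃ ∷ bs)
  W±1 : continuant W ≡±1
  W±1 = λ-quiddity-inner-±1 b W _
    (subst (λ bs′ → IsλQuiddity (b ∷ bs′)) (dropLast-++-lastOr0 b₂ (b₃ ∷ bs)) quiddity)
  short : length W ℕ.+ 3 ≤ length a⊕b
  short = begin
    length W ℕ.+ 3          ≡⟨ ℕ.+-comm (length W) 3 ⟩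
    3 ℕ.+ length W          ≤⟨ ℕ.+-monoˡ-≤ (length W) (subst (3 ≤_) (sym |P|≡|a|) 3≤|a|) ⟩
    length P ℕ.+ length W   ≡⟨ List.length-++ P ⟨
    length (P ++ W)         ≡⟨ cong length a⊕b≡P++W ⟨
    length a⊕b              ∎
    where open ℕ.≤-Reasoning
  window : c ∼ a⊕b → ±1-Window c
  window (k , _ , inj₁ c≡rot) = rotation⇒±1-Window k _ P W [] c≡rot
    (trans a⊕b≡P++W (cong (P ++_) (sym (List.++-identityʳ W)))) (λ ()) short W±1
  window (k , _ , inj₂ c≡rot) = rotation⇒±1-Window k _ [] (reverse W) (reverse P) c≡rot
    (trans (cong reverse a⊕b≡P++W) (List.reverse-++ P W))
    (λ rev-W≡[] → ℕ.1+n≢0 (trans (sym (List.length-reverse W)) (cong length rev-W≡[])))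
    (subst₂ (λ m n → m ℕ.+ 3 ≤ n) (sym (List.length-reverse W)) (sym (List.length-reverse a⊕b)) short)
    (subst _≡±1 (sym (continuant-reverse W)) W±1)
reducible⇒±1-Window c ([] , _ , _ , () , _)
reducible⇒±1-Window c (_ ∷ [] , _ , _ , s≤s () , _)
reducible⇒±1-Window c (_ ∷ _ ∷ _ , [] , _ , _ , () , _)
reducible⇒±1-Window c (_ ∷ _ ∷ _ , _ ∷ [] , _ , _ , s≤s () , _)
reducible⇒±1-Window c (_ ∷ _ ∷ _ , _ ∷ _ ∷ [] , _ , _ , s≤s (s≤s ()) , _)

data Avoid±1 : ℕ → ℚ × ℚ → List ℚ → Set where
  done : ∀ {v L} → Avoid±1 zero v L
  _∷_  : ∀ {f v a L} → ¬ proj₁ (step a v) ≡±1 → Avoid±1 f (step a v) L → Avoid±1 (suc f) v (a ∷ L)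

Avoid±1-prefix : ∀ {f v} Q Y → Avoid±1 f v (Q ++ Y) → Q ≢ [] → length Q ≤ f → ¬ proj₁ (run v Q) ≡±1
Avoid±1-prefix []          Y _           []≢[] _           = contradiction refl []≢[]
Avoid±1-prefix (a ∷ [])    Y (¬±1 ∷ _)   _     _           = ¬±1
Avoid±1-prefix (a ∷ b ∷ Q) Y (_ ∷ avoid) _     (s≤s |Q|≤f) = Avoid±1-prefix (b ∷ Q) Y avoid (λ ()) |Q|≤f

windows-avoid±1⇒¬Reducible : ∀ c →
  (∀ s → s < length c → Avoid±1 (length c ℕ.∸ 3) (1ℚ , 0ℚ) (drop s (c ++ c))) → ¬ Reducible c
windows-avoid±1⇒¬Reducible c avoid reducible =
  Avoid±1-prefix window after (subst (Avoid±1 _ _) splits (avoid start start<length)) nonempty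
    (ℕ.m+n≤o⇒m≤o∸n (length window) short) continuant±1
  where open ±1-Window (reducible⇒±1-Window c reducible)

Avoid±1-∷ : ∀ {f v a L} w → step a v ≡ w → ¬ proj₁ w ≡±1 → Avoid±1 f w L → Avoid±1 (suc f) v (a ∷ L)
Avoid±1-∷ w refl w≢±1 avoid = w≢±1 ∷ avoid

step-2-progression : ∀ y δ → step (ι 2) (y + δ , y) ≡ ((y + δ) + δ , y + δ)
step-2-progression y δ = cong (_, y + δ) (identity y δ)
  where
  identity : ∀ y δ → ι 2 * (y + δ) - y ≡ (y + δ) + δ
  identity = solve-∀ ℚ-ring

progression-double : ∀ y δ → (y + δ) + δ ≡ y + ι 2 * δ
progression-double = solve-∀ ℚ-ring

progression-shift : ∀ y δ k → (y + δ) + ι k * δ ≡ y + ι (suc k) * δ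
progression-shift y δ k = trans (identity y δ (ι k)) (cong (λ x → y + x * δ) (sym (ι-suc k)))
  where
  identity : ∀ y δ x → (y + δ) + x * δ ≡ y + (1ℚ + x) * δ
  identity = solve-∀ ℚ-ring

progression-start : ∀ y δ → (y + ι 1 * δ , y + ι 0 * δ) ≡ (y + δ , y)
progression-start y δ = cong₂ _,_ (identity₁ y δ) (identity₀ y δ)
  where
  identity₁ : ∀ y δ → y + 1ℚ * δ ≡ y + δ
  identity₁ = solve-∀ ℚ-ring
  identity₀ : ∀ y δ → y + 0ℚ * δ ≡ y
  identity₀ = solve-∀ ℚ-ring

run-twos : ∀ k y δ → run (y + δ , y) (replicate k (ι 2)) ≡ (y + ι (suc k) * δ , y + ι k * δ)
run-twos zero    y δ = sym (progression-start y δ)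
run-twos (suc k) y δ = begin
  run (step (ι 2) (y + δ , y)) twos                ≡⟨ cong (λ v → run v twos) (step-2-progression y δ) ⟩
  run ((y + δ) + δ , y + δ) twos                  ≡⟨ run-twos k (y + δ) δ ⟩
  ((y + δ) + ι (suc k) * δ , (y + δ) + ι k * δ)   ≡⟨ cong₂ _,_ (progression-shift y δ (suc k)) (progression-shift y δ k) ⟩
  (y + ι (suc (suc k)) * δ , y + ι (suc k) * δ)   ∎
  where
  open ≡-Reasoning
  twos = replicate k (ι 2)

Avoid±1-twos : ∀ {f k} y δ L → f ≤ k → (∀ j → j < f → ¬ (y + ι (suc (suc j)) * δ) ≡±1) →
               Avoid±1 f (y + δ , y) (replicate k (ι 2) ++ L)
Avoid±1-twos {zero}          y δ L _         _      = done
Avoid±1-twos {suc f} {suc k} y δ L (s≤s f≤k) values =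
  Avoid±1-∷ _ (step-2-progression y δ)
    (subst (λ x → ¬ x ≡±1) (sym (progression-double y δ)) (values 0 (s≤s z≤n)))
    (Avoid±1-twos (y + δ) δ L f≤k λ j j<f →
      subst (λ x → ¬ x ≡±1) (sym (progression-shift y δ (suc (suc j)))) (values (suc j) (s≤s j<f)))

Avoid±1-twos-++ : ∀ {f} k y δ L → (∀ j → j < k → ¬ (y + ι (suc (suc j)) * δ) ≡±1) →
                  Avoid±1 f (y + ι (suc k) * δ , y + ι k * δ) L →
                  Avoid±1 (k ℕ.+ f) (y + δ , y) (replicate k (ι 2) ++ L)
Avoid±1-twos-++ {f} zero    y δ L _      avoid = subst (λ v → Avoid±1 f v L) (progression-start y δ) avoid
Avoid±1-twos-++ {f} (suc k) y δ L values avoid =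
  Avoid±1-∷ _ (step-2-progression y δ)
    (subst (λ x → ¬ x ≡±1) (sym (progression-double y δ)) (values 0 (s≤s z≤n)))
    (Avoid±1-twos-++ k (y + δ) δ L
      (λ j j<k → subst (λ x → ¬ x ≡±1) (sym (progression-shift y δ (suc (suc j)))) (values (suc j) (s≤s j<k)))
      (subst (λ v → Avoid±1 f v L) (sym (cong₂ _,_ (progression-shift y δ (suc k)) (progression-shift y δ k))) avoid))

step-2-descending : ∀ b → step (ι 2) (ι (suc b) , ι (suc (suc b))) ≡ (ι b , ι (suc b))
step-2-descending b = cong (_, ι (suc b)) (begin
  ι 2 * ι (suc b) - ι (suc (suc b))       ≡⟨ cong₂ (λ x y → ι 2 * x - y) (ι-suc b) ι-2+b ⟩
  ι 2 * (1ℚ + ι b) - (1ℚ + (1ℚ + ι b))    ≡⟨ identity (ι b) ⟩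
  ι b                                     ∎)
  where
  open ≡-Reasoning
  ι-2+b : ι (suc (suc b)) ≡ 1ℚ + (1ℚ + ι b)
  ι-2+b = trans (ι-suc (suc b)) (cong (_+_ 1ℚ) (ι-suc b))
  identity : ∀ x → ι 2 * (1ℚ + x) - (1ℚ + (1ℚ + x)) ≡ x
  identity = solve-∀ ℚ-ring

Avoid±1-descending : ∀ {f k} b L → f ≤ k → f ℕ.+ 2 ≤ b → Avoid±1 f (ι b , ι (suc b)) (replicate k (ι 2) ++ L)
Avoid±1-descending {zero}          b       L _         _           = done
Avoid±1-descending {suc f} {suc k} (suc b) L (s≤s f≤k) (s≤s f+2≤b) =
  Avoid±1-∷ _ (step-2-descending b) (ι-≢±1 b (ℕ.m+n≤o⇒n≤o f f+2≤b)) (Avoid±1-descending b L f≤k f+2≤b)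

step-3-descending : ∀ x → step (ι 3) (x , 1ℚ + ι 2 * x) ≡ (x - 1ℚ , x)
step-3-descending x = cong (_, x) (identity x)
  where
  identity : ∀ x → ι 3 * x - (1ℚ + ι 2 * x) ≡ x - 1ℚ
  identity = solve-∀ ℚ-ring

Avoid±1-3∷twos : ∀ f {k} L → f ≤ suc k →
                 Avoid±1 f (ι (suc (suc f)) , 1ℚ + ι 2 * ι (suc (suc f))) (ι 3 ∷ replicate k (ι 2) ++ L)
Avoid±1-3∷twos zero    L _         = done
Avoid±1-3∷twos (suc f) L (s≤s f≤k) =
  Avoid±1-∷ _ (trans (step-3-descending (ι (3 ℕ.+ f))) (cong (_, ι (3 ℕ.+ f)) predecessor))
    (ι-≢±1 (2 ℕ.+ f) (s≤s (s≤s z≤n)))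
    (Avoid±1-descending (2 ℕ.+ f) L f≤k (ℕ.≤-reflexive (ℕ.+-comm f 2)))
  where
  identity : ∀ x → (1ℚ + x) - 1ℚ ≡ x
  identity = solve-∀ ℚ-ring
  predecessor : ι (3 ℕ.+ f) - 1ℚ ≡ ι (2 ℕ.+ f)
  predecessor = trans (cong (_- 1ℚ) (ι-suc (2 ℕ.+ f))) (identity (ι (2 ℕ.+ f)))

≤-double : ∀ {k} n a → k ≡ n ℕ.+ a → a ≤ n → k ≤ 2 ℕ.* n
≤-double n a refl a≤n = ℕ.+-monoʳ-≤ n (subst (a ≤_) (sym (ℕ.+-identityʳ n)) a≤n)

module Entries (n : ℕ) where

  N u D α β : ℚ
  N = ι n
  u = + 1 / suc (2 ℕ.* n)
  D = ι (suc (2 ℕ.* n))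
  α = + suc n / suc (2 ℕ.* n)
  β = + (2 ℕ.* n) / suc (2 ℕ.* n)

  D≡ : D ≡ 1ℚ + ι 2 * N
  D≡ = trans (ι-suc (2 ℕ.* n)) (cong (_+_ 1ℚ) (ι-* 2 n))

  α≡ : α ≡ ι (suc n) * u
  α≡ = /≡ι*1/ (suc n) (2 ℕ.* n)

  β≡ : β ≡ ι 2 * N * u
  β≡ = trans (/≡ι*1/ (2 ℕ.* n) (2 ℕ.* n)) (cong (_* u) (ι-* 2 n))

  u-inverse : u * (1ℚ + ι 2 * N) - 1ℚ ≡ 0ℚ
  u-inverse = begin
    u * (1ℚ + ι 2 * N) - 1ℚ   ≡⟨ cong (λ d → u * d - 1ℚ) D≡ ⟨
    u * D - 1ℚ                ≡⟨ cong (_- 1ℚ) (/-*-cancel 1 (2 ℕ.* n)) ⟩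
    0ℚ                        ∎
    where open ≡-Reasoning

  tuple-++ : ∀ L → tuple n ++ L ≡ D ∷ α ∷ ι 3 ∷ replicate (n ℕ.∸ 1) (ι 2) ++ β ∷ L
  tuple-++ L = cong (λ T → D ∷ α ∷ ι 3 ∷ T) (List.++-assoc (replicate (n ℕ.∸ 1) (ι 2)) (β ∷ []) L)

  D-from-start : step D (1ℚ , 0ℚ) ≡ (D , 1ℚ)
  D-from-start = cong (_, 1ℚ) (identity D)
    where
    identity : ∀ x → x * 1ℚ - 0ℚ ≡ x
    identity = solve-∀ ℚ-ring

  α-after-D : step α (D , 1ℚ) ≡ (N , 1ℚ + ι 2 * N)
  α-after-D = cong₂ _,_ (begin
    α * D - 1ℚ                           ≡⟨ cong₂ (λ a d → a * d - 1ℚ) (trans α≡ (cong (_* u) (ι-suc n))) D≡ ⟩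
    (1ℚ + N) * u * (1ℚ + ι 2 * N) - 1ℚ   ≡⟨ modulo N (1ℚ + N) u-inverse (identity N u) ⟩
    N                                    ∎) D≡
    where
    open ≡-Reasoning
    identity : ∀ N u → (1ℚ + N) * u * (1ℚ + ι 2 * N) - 1ℚ ≡ N + (1ℚ + N) * (u * (1ℚ + ι 2 * N) - 1ℚ)
    identity = solve-∀ ℚ-ring

M-tuple : ∀ k → M (tuple (suc k)) ≡ negId
M-tuple k = trans (M-columns (tuple (suc k))) (cong₂ fromColumns first-column second-column)
  where
  open Entries (suc k)
  open ≡-Reasoning
  K : ℚ
  K = ι k
  twos : List ℚ
  twos = replicate k (ι 2)
  finish : ℚ × ℚ → ℚ × ℚ
  finish v = step β (run v twos)
  run-tuple : ∀ v → run v (tuple (suc k)) ≡ finish (step (ι 3) (step α (step D v)))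
  run-tuple v = List.foldl-++ _ v (D ∷ α ∷ ι 3 ∷ twos) (β ∷ [])
  absorb : ∀ x → x * 0ℚ - 1ℚ ≡ - 1ℚ
  absorb = solve-∀ ℚ-ring

  first-column : run (1ℚ , 0ℚ) (tuple (suc k)) ≡ (- 1ℚ , 0ℚ)
  first-column = begin
    run (1ℚ , 0ℚ) (tuple (suc k))                        ≡⟨ run-tuple (1ℚ , 0ℚ) ⟩
    finish (step (ι 3) (step α (step D (1ℚ , 0ℚ))))      ≡⟨ cong (λ v → finish (step (ι 3) (step α v))) D-from-start ⟩
    finish (step (ι 3) (step α (D , 1ℚ)))                ≡⟨ cong (λ v → finish (step (ι 3) v)) α-after-D ⟩
    finish (step (ι 3) (N , 1ℚ + ι 2 * N))               ≡⟨ cong finish (step-3-descending N) ⟩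
    step β (run (N - 1ℚ , N) twos)                       ≡⟨ cong (step β) (run-twos k N (- 1ℚ)) ⟩
    step β (N + N * - 1ℚ , N + K * - 1ℚ)                 ≡⟨ cong₂ (λ x y → step β (x , y)) (cancel N) last-but-one ⟩
    step β (0ℚ , 1ℚ)                                     ≡⟨ cong (_, 0ℚ) (absorb β) ⟩
    (- 1ℚ , 0ℚ)                                          ∎
    where
    cancel : ∀ x → x + x * - 1ℚ ≡ 0ℚ
    cancel = solve-∀ ℚ-ring
    cancel₁ : ∀ x → (1ℚ + x) + x * - 1ℚ ≡ 1ℚ
    cancel₁ = solve-∀ ℚ-ring
    last-but-one : N + K * - 1ℚ ≡ 1ℚ
    last-but-one = trans (cong (λ x → x + K * - 1ℚ) (ι-suc k)) (cancel₁ K)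

  second-column : run (0ℚ , 1ℚ) (tuple (suc k)) ≡ (0ℚ , - 1ℚ)
  second-column = begin
    run (0ℚ , 1ℚ) (tuple (suc k))                        ≡⟨ run-tuple (0ℚ , 1ℚ) ⟩
    finish (step (ι 3) (step α (step D (0ℚ , 1ℚ))))      ≡⟨ cong (λ x → finish (step (ι 3) (step α (x , 0ℚ)))) (absorb D) ⟩
    finish (step (ι 3) (step α (- 1ℚ , 0ℚ)))             ≡⟨ cong (λ x → finish (step (ι 3) (x , - 1ℚ))) (negate α) ⟩
    finish (step (ι 3) (- α , - 1ℚ))                     ≡⟨ cong (λ x → finish (x , - α)) 3-step ⟩
    step β (run (- α + - u , - α) twos)                  ≡⟨ cong (step β) (run-twos k (- α) (- u)) ⟩
    step β (- α + N * - u , - α + K * - u)               ≡⟨ cong₂ (λ x y → step β (x , y)) last last-but-one ⟩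
    step β (- 1ℚ , - β)                                  ≡⟨ cong (_, - 1ℚ) (cancel β) ⟩
    (0ℚ , - 1ℚ)                                          ∎
    where
    α≡′ : α ≡ (1ℚ + N) * u
    α≡′ = trans α≡ (cong (_* u) (ι-suc (suc k)))
    negate : ∀ x → x * - 1ℚ - 0ℚ ≡ - x
    negate = solve-∀ ℚ-ring
    cancel : ∀ x → x * - 1ℚ - - x ≡ 0ℚ
    cancel = solve-∀ ℚ-ring
    3-step : ι 3 * - α - - 1ℚ ≡ - α + - u
    3-step = begin
      ι 3 * - α - - 1ℚ                ≡⟨ cong (λ a → ι 3 * - a - - 1ℚ) α≡′ ⟩
      ι 3 * - ((1ℚ + N) * u) - - 1ℚ   ≡⟨ modulo _ (- 1ℚ) u-inverse (identity N u) ⟩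
      - ((1ℚ + N) * u) + - u          ≡⟨ cong (λ a → - a + - u) α≡′ ⟨
      - α + - u                       ∎
      where
      identity : ∀ N u → ι 3 * - ((1ℚ + N) * u) - - 1ℚ ≡
                 (- ((1ℚ + N) * u) + - u) + - 1ℚ * (u * (1ℚ + ι 2 * N) - 1ℚ)
      identity = solve-∀ ℚ-ring
    last : - α + N * - u ≡ - 1ℚ
    last = begin
      - α + N * - u                ≡⟨ cong (λ a → - a + N * - u) α≡′ ⟩
      - ((1ℚ + N) * u) + N * - u   ≡⟨ modulo _ (- 1ℚ) u-inverse (identity N u) ⟩
      - 1ℚ                         ∎
      where
      identity : ∀ N u → - ((1ℚ + N) * u) + N * - u ≡ - 1ℚ + - 1ℚ * (u * (1ℚ + ι 2 * N) - 1ℚ)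
      identity = solve-∀ ℚ-ring
    last-but-one : - α + K * - u ≡ - β
    last-but-one = begin
      - α + K * - u                       ≡⟨ cong (λ a → - a + K * - u) α≡″ ⟩
      - ((1ℚ + (1ℚ + K)) * u) + K * - u   ≡⟨ identity K u ⟩
      - (ι 2 * (1ℚ + K) * u)              ≡⟨ cong (λ x → - (ι 2 * x * u)) (ι-suc k) ⟨
      - (ι 2 * N * u)                     ≡⟨ cong -_ β≡ ⟨
      - β                                 ∎
      where
      α≡″ : α ≡ (1ℚ + (1ℚ + K)) * u
      α≡″ = trans α≡′ (cong (λ x → (1ℚ + x) * u) (ι-suc k))
      identity : ∀ K u → - ((1ℚ + (1ℚ + K)) * u) + K * - u ≡ - (ι 2 * (1ℚ + K) * u)
      identity = solve-∀ ℚ-ring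

length-tuple : ∀ k → length (tuple (suc k)) ≡ 3 ℕ.+ suc k
length-tuple k = cong (3 ℕ.+_) (trans (List.length-++ (replicate k (ι 2)))
  (trans (cong (ℕ._+ 1) (List.length-replicate k)) (ℕ.+-comm k 1)))

windows-from-D : ∀ m → Avoid±1 (suc (suc m)) (1ℚ , 0ℚ) (tuple (suc (suc m)) ++ tuple (suc (suc m)))
windows-from-D m = subst (Avoid±1 _ _) (sym (tuple-++ (tuple (suc (suc m)))))
  (Avoid±1-∷ _ D-from-start (ι-≢±1 (suc (2 ℕ.* suc (suc m))) (s≤s (s≤s z≤n)))
  (Avoid±1-∷ _ α-after-D (ι-≢±1 (suc (suc m)) (s≤s (s≤s z≤n)))
  (Avoid±1-3∷twos m _ (ℕ.m≤n⇒m≤1+n (ℕ.n≤1+n m)))))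
  where open Entries (suc (suc m))

windows-from-α : ∀ m → Avoid±1 (suc (suc m)) (1ℚ , 0ℚ) (drop 1 (tuple (suc (suc m)) ++ tuple (suc (suc m))))
windows-from-α m = subst (Avoid±1 _ _) (sym (cong (drop 1) (tuple-++ (tuple n))))
  (Avoid±1-∷ _ α-from-start (ι*1/-≢±1 (suc n) (2 ℕ.* n) (≤-double n 1 (ℕ.+-comm 1 n) (s≤s z≤n)))
  (Avoid±1-∷ _ 3-after-α
    (subst (λ x → ¬ x ≡±1) (sym (ι*-suc (suc n) u))
      (ι*1/-≢±1 (suc (suc n)) (2 ℕ.* n) (≤-double n 2 (ℕ.+-comm 2 n) (s≤s (s≤s z≤n)))))
  (Avoid±1-twos (ι (suc n) * u) u _ (ℕ.n≤1+n m) values)))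
  where
  n = suc (suc m)
  open Entries n
  open ≡-Reasoning
  α-from-start : step α (1ℚ , 0ℚ) ≡ (ι (suc n) * u , 1ℚ)
  α-from-start = cong (_, 1ℚ) (trans (identity α) α≡)
    where
    identity : ∀ x → x * 1ℚ - 0ℚ ≡ x
    identity = solve-∀ ℚ-ring
  3-after-α : step (ι 3) (ι (suc n) * u , 1ℚ) ≡ (ι (suc n) * u + u , ι (suc n) * u)
  3-after-α = cong (_, ι (suc n) * u) (begin
    ι 3 * (ι (suc n) * u) - 1ℚ   ≡⟨ cong (λ x → ι 3 * (x * u) - 1ℚ) (ι-suc n) ⟩
    ι 3 * ((1ℚ + N) * u) - 1ℚ    ≡⟨ modulo _ 1ℚ u-inverse (identity N u) ⟩
    (1ℚ + N) * u + u             ≡⟨ cong (λ x → x * u + u) (ι-suc n) ⟨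
    ι (suc n) * u + u            ∎)
    where
    identity : ∀ N u → ι 3 * ((1ℚ + N) * u) - 1ℚ ≡ ((1ℚ + N) * u + u) + 1ℚ * (u * (1ℚ + ι 2 * N) - 1ℚ)
    identity = solve-∀ ℚ-ring
  values : ∀ j → j < m → ¬ (ι (suc n) * u + ι (suc (suc j)) * u) ≡±1
  values j j<m = subst (λ x → ¬ x ≡±1) (sym (ι*-+ (suc n) (suc (suc j)) u))
    (ι*1/-≢±1 _ (2 ℕ.* n) (≤-double n (3 ℕ.+ j) (sym (ℕ.+-suc n (suc (suc j)))) (s≤s (s≤s j<m))))

windows-from-3 : ∀ m → Avoid±1 (suc (suc m)) (1ℚ , 0ℚ) (drop 2 (tuple (suc (suc m)) ++ tuple (suc (suc m))))
windows-from-3 m = subst (Avoid±1 _ _) (sym (cong (drop 2) (tuple-++ (tuple (suc (suc m))))))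
  (Avoid±1-∷ (1ℚ + ι 2 , 1ℚ) refl (ι-≢±1 3 (s≤s (s≤s z≤n)))
  (Avoid±1-twos 1ℚ (ι 2) _ ℕ.≤-refl values))
  where
  open Entries (suc (suc m))
  values : ∀ j → j < suc m → ¬ (1ℚ + ι (suc (suc j)) * ι 2) ≡±1
  values j _ = subst (λ x → ¬ x ≡±1) (trans (ι-suc (suc (suc j) ℕ.* 2)) (cong (_+_ 1ℚ) (ι-* (suc (suc j)) 2)))
    (ι-≢±1 (suc (suc (suc j) ℕ.* 2)) (s≤s (s≤s z≤n)))

-- A window that starts with r of the 2s and then passes through β, D, α, 3, 2, …;
-- here n = 1 + i + r, and i + 1 entries of the window are left after the r 2s.
module AfterTwos (i r : ℕ) where
  open Entries (suc (i ℕ.+ r)) public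

  I R x₁ : ℚ
  I = ι i
  R = ι r
  x₁ = ι (r ℕ.+ 2 ℕ.* suc i) * u

  N≡ : N ≡ 1ℚ + (I + R)
  N≡ = trans (ι-suc (i ℕ.+ r)) (cong (_+_ 1ℚ) (ι-+ i r))

  u-inverse′ : u * (1ℚ + ι 2 * (1ℚ + (I + R))) - 1ℚ ≡ 0ℚ
  u-inverse′ = trans (cong (λ x → u * (1ℚ + ι 2 * x) - 1ℚ) (sym N≡)) u-inverse

  numerator≡ : ι (r ℕ.+ 2 ℕ.* suc i) ≡ R + ι 2 * (1ℚ + I)
  numerator≡ = trans (ι-+ r (2 ℕ.* suc i)) (cong (_+_ R) (trans (ι-* 2 (suc i)) (cong (ι 2 *_) (ι-suc i))))

  odd≡ : ι (suc (2 ℕ.* i)) ≡ 1ℚ + ι 2 * I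
  odd≡ = trans (ι-suc (2 ℕ.* i)) (cong (_+_ 1ℚ) (ι-* 2 i))

  x₁≢±1 : ¬ x₁ ≡±1
  x₁≢±1 = ι*1/-≢±1 _ (2 ℕ.* suc (i ℕ.+ r)) (≤-double (suc (i ℕ.+ r)) (suc i) (numerator i r) (s≤s (ℕ.m≤m+n i r)))
    where
    numerator : ∀ i r → r ℕ.+ 2 ℕ.* suc i ≡ suc (i ℕ.+ r) ℕ.+ suc i
    numerator = ℕ-Solver.solve-∀

  β-step : step β (ι (suc r) , R) ≡ (x₁ , ι (suc r))
  β-step = cong (_, ι (suc r)) (begin
    β * ι (suc r) - R                         ≡⟨ cong₂ (λ b s → b * s - R) β≡′ (ι-suc r) ⟩
    ι 2 * (1ℚ + (I + R)) * u * (1ℚ + R) - R   ≡⟨ modulo _ R u-inverse′ (identity I R u) ⟩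
    (R + ι 2 * (1ℚ + I)) * u                  ≡⟨ cong (_* u) numerator≡ ⟨
    x₁                                        ∎)
    where
    open ≡-Reasoning
    β≡′ : β ≡ ι 2 * (1ℚ + (I + R)) * u
    β≡′ = trans β≡ (cong (λ x → ι 2 * x * u) N≡)
    identity : ∀ I R u → ι 2 * (1ℚ + (I + R)) * u * (1ℚ + R) - R ≡
               (R + ι 2 * (1ℚ + I)) * u + R * (u * (1ℚ + ι 2 * (1ℚ + (I + R))) - 1ℚ)
    identity = solve-∀ ℚ-ring

  D-step : step D (x₁ , ι (suc r)) ≡ (ι (suc (2 ℕ.* i)) , x₁)
  D-step = cong (_, x₁) (begin
    D * x₁ - ι (suc r)
      ≡⟨ cong₃ (λ d a s → d * (a * u) - s) (trans D≡ (cong (λ x → 1ℚ + ι 2 * x) N≡)) numerator≡ (ι-suc r) ⟩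
    (1ℚ + ι 2 * (1ℚ + (I + R))) * ((R + ι 2 * (1ℚ + I)) * u) - (1ℚ + R)
      ≡⟨ modulo _ (R + ι 2 * (1ℚ + I)) u-inverse′ (identity I R u) ⟩
    1ℚ + ι 2 * I
      ≡⟨ odd≡ ⟨
    ι (suc (2 ℕ.* i))
      ∎)
    where
    open ≡-Reasoning
    identity : ∀ I R u → (1ℚ + ι 2 * (1ℚ + (I + R))) * ((R + ι 2 * (1ℚ + I)) * u) - (1ℚ + R) ≡
               (1ℚ + ι 2 * I) + (R + ι 2 * (1ℚ + I)) * (u * (1ℚ + ι 2 * (1ℚ + (I + R))) - 1ℚ)
    identity = solve-∀ ℚ-ring

  α-step : step α (ι (suc (2 ℕ.* i)) , x₁) ≡ (I , 1ℚ + ι 2 * I)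
  α-step = cong₂ _,_ (begin
    α * ι (suc (2 ℕ.* i)) - x₁
      ≡⟨ cong₃ (λ a o x → a * o - x * u) α≡′ odd≡ numerator≡ ⟩
    (1ℚ + (1ℚ + (I + R))) * u * (1ℚ + ι 2 * I) - (R + ι 2 * (1ℚ + I)) * u
      ≡⟨ modulo _ I u-inverse′ (identity I R u) ⟩
    I
      ∎) odd≡
    where
    open ≡-Reasoning
    α≡′ : α ≡ (1ℚ + (1ℚ + (I + R))) * u
    α≡′ = trans α≡ (cong (_* u) (trans (ι-suc (suc (i ℕ.+ r))) (cong (_+_ 1ℚ) N≡)))
    identity : ∀ I R u → (1ℚ + (1ℚ + (I + R))) * u * (1ℚ + ι 2 * I) - (R + ι 2 * (1ℚ + I)) * u ≡
               I + I * (u * (1ℚ + ι 2 * (1ℚ + (I + R))) - 1ℚ)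
    identity = solve-∀ ℚ-ring

Avoid±1-β∷tuple : ∀ i r → Avoid±1 (suc i) (ι (suc r) , ι r) (Entries.β (suc (i ℕ.+ r)) ∷ tuple (suc (i ℕ.+ r)))
Avoid±1-β∷tuple zero r = Avoid±1-∷ _ β-step x₁≢±1 done
  where open AfterTwos zero r
Avoid±1-β∷tuple (suc zero) r =
  Avoid±1-∷ _ β-step x₁≢±1 (Avoid±1-∷ _ D-step (ι-≢±1 3 (s≤s (s≤s z≤n))) done)
  where open AfterTwos 1 r
Avoid±1-β∷tuple (suc (suc f)) r =
  Avoid±1-∷ _ β-step x₁≢±1
  (Avoid±1-∷ _ D-step (ι-≢±1 (suc (2 ℕ.* suc (suc f))) (s≤s (s≤s z≤n)))
  (Avoid±1-∷ _ α-step (ι-≢±1 (suc (suc f)) (s≤s (s≤s z≤n)))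
  (Avoid±1-3∷twos f _ (ℕ.≤-trans (ℕ.m≤m+n f r) (ℕ.m≤n+m (f ℕ.+ r) 3)))))
  where open AfterTwos (suc (suc f)) r

windows-from-twos : ∀ k i r → i ℕ.+ r ≡ k →
                    Avoid±1 (suc k) (1ℚ , 0ℚ) (drop (3 ℕ.+ i) (tuple (suc k) ++ tuple (suc k)))
windows-from-twos .(i ℕ.+ r) i r refl = subst₂ (λ f L → Avoid±1 f (1ℚ , 0ℚ) L) fuel list
  (Avoid±1-twos-++ r 0ℚ 1ℚ _ values (subst (λ v → Avoid±1 (suc i) v (β ∷ c)) state (Avoid±1-β∷tuple i r)))
  where
  open Entries (suc (i ℕ.+ r))
  c = tuple (suc (i ℕ.+ r))
  list : replicate r (ι 2) ++ β ∷ c ≡ drop (3 ℕ.+ i) (c ++ c)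
  list = sym (trans (cong (drop (3 ℕ.+ i)) (tuple-++ c)) (drop-replicate-++ i r (ι 2) _))
  fuel : r ℕ.+ suc i ≡ suc (i ℕ.+ r)
  fuel = trans (ℕ.+-suc r i) (cong suc (ℕ.+-comm r i))
  scaled : ∀ x → 0ℚ + x * 1ℚ ≡ x
  scaled = solve-∀ ℚ-ring
  state : (ι (suc r) , ι r) ≡ (0ℚ + ι (suc r) * 1ℚ , 0ℚ + ι r * 1ℚ)
  state = sym (cong₂ _,_ (scaled (ι (suc r))) (scaled (ι r)))
  values : ∀ j → j < r → ¬ (0ℚ + ι (suc (suc j)) * 1ℚ) ≡±1
  values j _ = subst (λ x → ¬ x ≡±1) (sym (scaled (ι (suc (suc j))))) (ι-≢±1 (suc (suc j)) (s≤s (s≤s z≤n)))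

tuple-windows-avoid±1 : ∀ m → let c = tuple (suc (suc m)) in
                        ∀ s → s < length c → Avoid±1 (length c ℕ.∸ 3) (1ℚ , 0ℚ) (drop s (c ++ c))
tuple-windows-avoid±1 m s s<|c| =
  subst (λ f → Avoid±1 f (1ℚ , 0ℚ) (drop s (c ++ c))) (cong (ℕ._∸ 3) (sym (length-tuple (suc m))))
    (window s (subst (s <_) (length-tuple (suc m)) s<|c|))
  where
  c = tuple (suc (suc m))
  window : ∀ s → s < 3 ℕ.+ suc (suc m) → Avoid±1 (suc (suc m)) (1ℚ , 0ℚ) (drop s (c ++ c))
  window 0 _ = windows-from-D m
  window 1 _ = windows-from-α m
  window 2 _ = windows-from-3 m
  window (suc (suc (suc i))) (s≤s (s≤s (s≤s (s≤s i≤1+m))))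
    with r , i+r≡1+m ← ℕ.m≤n⇒∃[o]m+o≡n i≤1+m = windows-from-twos (suc m) i r i+r≡1+m

proposition3p10 : (n : ℕ) → 2 ≤ n → IsIrreducibleλQuiddity (tuple n)
proposition3p10 (suc zero)    (s≤s ())
proposition3p10 (suc (suc m)) _ =
  inj₂ (M-tuple (suc m)) ,
  subst (3 ≤_) (sym (length-tuple (suc m))) (ℕ.m≤m+n 3 (suc (suc m))) ,
  windows-avoid±1⇒¬Reducible (tuple (suc (suc m))) (tuple-windows-avoid±1 m)
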